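{- Let $G$ be a connected finite simple graph with $|V(G)|\ge 3$. If $\det(G)\ne 1$, then $\det'(G)\le \det(G)$.
   Context: A vertex set $S$ is a vertex determining set if the only automorphism of $G$ fixing every vertex of $S$ is the identity; $\det(G)$ is the minimum size of such a set. For a graph with at most one isolated vertex and no $K_2$ component, an edge set $T$ is an edge determining set if the only automorphism $\phi$ with $\{\phi(u),\phi(v)\}=\{u,v\}$ for all $\{u,v\}\in T$ is the identity; $\det'(G)$ is the minimum size of such a set. -}

module Defs where

open import Data.Nat using (ℕ; _≤_)
open import Data.Fin using (Fin)
open import Data.List using (List; length)
open import Data.List.Relation.Unary.All using (All)
open import Data.Product using (_×_; _,_; Σ)
open import Data.Sum using (_⊎_)
open import Data.Empty using (⊥)
open import Relation.Binary.PropositionalEquality using (_≡_)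
open import Relation.Binary.Construct.Closure.ReflexiveTransitive using (Star)
open import Function.Bundles using (_↔_; Inverse; _⇔_)
open import Level using (0ℓ)

record Graph (n : ℕ) : Set₁ where
  field
    Adj   : Fin n → Fin n → Set
    sym   : ∀ {u v} → Adj u v → Adj v u
    irrfl : ∀ {u} → Adj u u → ⊥
open Graph public

Connected : ∀ {n} → Graph n → Set
Connected G = ∀ u v → Star (Adj G) u v

record Automorphism {n : ℕ} (G : Graph n) : Set where
  field
    perm     : Fin n ↔ Fin n
    preserve : ∀ u v → Adj G u v ⇔ Adj G (Inverse.to perm u) (Inverse.to perm v)
open Automorphism public

app : ∀ {n} {G : Graph n} → Automorphism G → Fin n → Fin n
app φ = Inverse.to (perm φ)

IsIdentity : ∀ {n} {G : Graph n} → Automorphism G → Set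
IsIdentity φ = ∀ v → app φ v ≡ v

-- Vertex sets are given as lists (duplicates only increase length, so the minimum
-- length of a determining list equals the minimum size of a determining set).
IsVertexDetermining : ∀ {n} → Graph n → List (Fin n) → Set
IsVertexDetermining G S =
  (φ : Automorphism G) → All (λ v → app φ v ≡ v) S → IsIdentity φ

IsDet : ∀ {n} → Graph n → ℕ → Set
IsDet G k =
  Σ (List _) (λ S → IsVertexDetermining G S × length S ≡ k)
  × (∀ S → IsVertexDetermining G S → k ≤ length S)

-- An edge {u,v} of G, represented by an ordered pair with Adj u v.
Edge : ∀ {n} → Graph n → Set
Edge {n} G = Σ (Fin n × Fin n) (λ { (u , v) → Adj G u v })

FixesEdge : ∀ {n} {G : Graph n} → Automorphism G → Fin n × Fin n → Set
FixesEdge φ (u , v) = (app φ u ≡ u × app φ v ≡ v) ⊎ (app φ u ≡ v × app φ v ≡ u)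

IsEdgeDetermining : ∀ {n} (G : Graph n) → List (Edge G) → Set
IsEdgeDetermining G T =
  (φ : Automorphism G) → All (λ e → FixesEdge φ (Data.Product.proj₁ e)) T → IsIdentity φ

IsEdgeDet : ∀ {n} → Graph n → ℕ → Set
IsEdgeDet G k =
  Σ (List (Edge G)) (λ T → IsEdgeDetermining G T × length T ≡ k)
  × (∀ T → IsEdgeDetermining G T → k ≤ length T)

-- Let S = a, b, … be a minimum vertex determining set. For every other vertex v of S
-- take the first edge of a shortest path from v to a: once a is fixed, an automorphism
-- fixing that edge setwise cannot swap its ends, since that would move v to a vertex
-- closer to a. Two further edges pin a and b down: the ends of a shortest a–b path if
-- d(a, b) ≥ 2, and the edge ab together with an edge leaving {a, b} if d(a, b) = 1.
-- The resulting |S| edges form an edge determining set. Adjacency is not decidable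
-- here, so shortest paths only exist up to double negation; this suffices because
-- the conclusion d' ≤ d is decidable.
module Submission where

open import Defs hiding (sym)
open import Data.Nat using (ℕ; zero; suc; _+_; _≤_; _<_; _≤?_; s≤s)
open import Data.Nat.Properties using (n<1+n; m<n⇒m<1+n; 1+n≰n)
open import Data.Nat.Induction using (<-rec)
open import Data.Fin using (Fin; zero; suc; _≟_; punchIn; punchOut)
open import Data.Fin.Properties using (punchInᵢ≢i; punchIn-injective; punchIn-punchOut)
open import Data.List using (List; []; _∷_; length; map)
open import Data.List.Properties using (length-map)
open import Data.List.Relation.Unary.All as All using (All; []; _∷_)
open import Data.List.Relation.Unary.All.Properties using (map⁻)
open import Data.Product using (Σ-syntax; ∃; ∃₂; ∃-syntax; _×_; _,_; proj₁; proj₂)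
open import Data.Sum using (_⊎_; inj₁; inj₂; [_,_]′)
open import Effect.Monad using (RawMonad)
open import Function.Base using (_∘_)
open import Function.Bundles using (Equivalence)
open import Level using (0ℓ)
open import Relation.Binary.Core using (Rel)
open import Relation.Binary.Construct.Closure.ReflexiveTransitive using (Star; ε; _◅_)
open import Relation.Binary.PropositionalEquality using (_≡_; _≢_; refl; sym; trans; cong; subst; ≢-sym)
open import Relation.Nullary using (¬_; yes; no; contradiction)
open import Relation.Nullary.Decidable using (decidable-stable; ¬¬-excluded-middle; _⊎-dec_)
open import Relation.Nullary.Negation using (¬¬-Monad; ¬¬-map)
open import Relation.Unary using (Pred; Decidable)

open RawMonad (¬¬-Monad {0ℓ})

¬¬-pull-Fin : ∀ {n} {P : Fin n → Set} → (∀ i → ¬ ¬ P i) → ¬ ¬ (∀ i → P i)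
¬¬-pull-Fin {zero}  _ = pure λ ()
¬¬-pull-Fin {suc n} h = do
  p₀ ← h zero
  ps ← ¬¬-pull-Fin (h ∘ suc)
  pure λ { zero → p₀ ; (suc i) → ps i }

avoid-two : ∀ {m} (a b : Fin (suc (suc (suc m)))) → ∃[ c ] c ≢ a × c ≢ b
avoid-two a b with a ≟ b
... | yes refl = punchIn a zero , punchInᵢ≢i a zero , punchInᵢ≢i a zero
... | no a≢b = punchIn a (punchIn b′ zero) , punchInᵢ≢i a _ , c≢b
  where
  b′ = punchOut a≢b
  c≢b : punchIn a (punchIn b′ zero) ≢ b
  c≢b eq = punchInᵢ≢i b′ zero (punchIn-injective a _ _ (trans eq (sym (punchIn-punchOut a≢b))))

module _ {A : Set} {R : Rel A 0ℓ} where

  star-first-step : ∀ {u v} → u ≢ v → Star R u v → ∃ (R u)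
  star-first-step u≢u ε       = contradiction refl u≢u
  star-first-step _   (r ◅ _) = _ , r

  crossing-step : {P : Pred A 0ℓ} → Decidable P →
                  ∀ {u v} → Star R u v → P u → ¬ P v → ∃₂ λ x y → P x × ¬ P y × R x y
  crossing-step P? ε                   pu ¬pv = contradiction pu ¬pv
  crossing-step P? (_◅_ {j = w} r rs) pu ¬pv with P? w
  ... | yes pw  = crossing-step P? rs pw ¬pv
  ... | no  ¬pw = _ , _ , pu , ¬pw , r

Fixes : ∀ {n} {G : Graph n} → Automorphism G → Fin n → Set
Fixes φ v = app φ v ≡ v

module _ {n : ℕ} (G : Graph n) where

  data Walk : ℕ → Fin n → Fin n → Set where
    []  : ∀ {u} → Walk 0 u u
    _∷_ : ∀ {k u w v} → Adj G u w → Walk k w v → Walk (suc k) u v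

  star⇒walk : ∀ {u v} → Star (Adj G) u v → ∃[ k ] Walk k u v
  star⇒walk ε        = 0 , []
  star⇒walk (e ◅ es) = let k , w = star⇒walk es in suc k , e ∷ w

  unsnoc : ∀ {k u v} → Walk (suc k) u v → ∃[ y ] Walk k u y × Adj G y v
  unsnoc (e ∷ [])        = _ , [] , e
  unsnoc (e ∷ w@(_ ∷ _)) = let y , w′ , e′ = unsnoc w in y , e ∷ w′ , e′

  map-walk : (φ : Automorphism G) → ∀ {k u v} → Walk k u v → Walk k (app φ u) (app φ v)
  map-walk φ []      = []
  map-walk φ (e ∷ w) = Equivalence.to (preserve φ _ _) e ∷ map-walk φ w

  transport-walk : (φ : Automorphism G) → ∀ {k u v u′ v′} →
                   app φ u ≡ u′ → app φ v ≡ v′ → Walk k u v → Walk k u′ v′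
  transport-walk φ refl refl = map-walk φ

  Geodesic : ℕ → Fin n → Fin n → Set
  Geodesic k u v = Walk k u v × (∀ {j} → j < k → ¬ Walk j u v)

  ¬¬-geodesic : ∀ k {u v} → Walk k u v → ¬ ¬ (∃[ j ] Geodesic j u v)
  ¬¬-geodesic = <-rec _ λ k shorten {u} {v} w → do
    yes (j , j<k , w′) ← ¬¬-excluded-middle {A = ∃[ j ] j < k × Walk j u v}
      where no none → pure (k , w , λ {j} j<k w′ → none (j , j<k , w′))
    shorten j<k w′

  ¬¬-geodesic-connected : Connected G → ∀ u v → ¬ ¬ (∃[ k ] Geodesic k u v)
  ¬¬-geodesic-connected conn u v = let k , w = star⇒walk (conn u v) in ¬¬-geodesic k w

  FixingEdge : Fin n → Fin n → Set
  FixingEdge a v = Σ[ e ∈ Edge G ] (∀ (φ : Automorphism G) → Fixes φ a → FixesEdge φ (proj₁ e) → Fixes φ v)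

  FixingEdgePair : Fin n → Fin n → Set
  FixingEdgePair a b = Σ[ e ∈ Edge G ] Σ[ f ∈ Edge G ]
    (∀ (φ : Automorphism G) → FixesEdge φ (proj₁ e) → FixesEdge φ (proj₁ f) → Fixes φ a × Fixes φ b)

  fixing-edge : ∀ {k a v} → Geodesic k v a → ∃ (Adj G v) → FixingEdge a v
  fixing-edge ([] , _) (x , e) = (_ , e) , λ φ φa≡a _ → φa≡a
  fixing-edge {suc k} {a} {v} (_∷_ {w = x} e w , shortest) _ = (_ , e) , fixed
    where
    fixed : ∀ φ → Fixes φ a → FixesEdge φ (v , x) → Fixes φ v
    fixed φ _    (inj₁ (φv≡v , _)) = φv≡v
    fixed φ φa≡a (inj₂ (_ , φx≡v)) = contradiction (transport-walk φ φx≡v φa≡a w) (shortest (n<1+n k))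

  OneOf : Fin n → Fin n → Pred (Fin n) 0ℓ
  OneOf a b x = x ≡ a ⊎ x ≡ b

  one-of? : ∀ a b → Decidable (OneOf a b)
  one-of? a b x = x ≟ a ⊎-dec x ≟ b

  -- If φ swaps a and b, then φ w ∈ {a, b} is neither w nor the outside vertex z.
  fixing-edge-pair-adjacent : ∀ {a b w z} → a ≢ b → Adj G a b → Adj G w z →
                              OneOf a b w → ¬ OneOf a b z → FixingEdgePair a b
  fixing-edge-pair-adjacent {a} {b} {w} {z} a≢b e f w∈ab z∉ab = (_ , e) , (_ , f) , fixed w∈ab
    where
    fixed : OneOf a b w → ∀ φ → FixesEdge φ (a , b) → FixesEdge φ (w , z) → Fixes φ a × Fixes φ b
    fixed _           φ (inj₁ φab≡ab)      _                   = φab≡ab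
    fixed (inj₁ refl) φ (inj₂ (φa≡b , _)) (inj₁ (φa≡a , _)) = contradiction (trans (sym φa≡a) φa≡b) a≢b
    fixed (inj₁ refl) φ (inj₂ (φa≡b , _)) (inj₂ (φa≡z , _)) = contradiction (inj₂ (trans (sym φa≡z) φa≡b)) z∉ab
    fixed (inj₂ refl) φ (inj₂ (_ , φb≡a)) (inj₁ (φb≡b , _)) = contradiction (trans (sym φb≡b) φb≡a) (≢-sym a≢b)
    fixed (inj₂ refl) φ (inj₂ (_ , φb≡a)) (inj₂ (φb≡z , _)) = contradiction (inj₁ (trans (sym φb≡z) φb≡a)) z∉ab

  -- The first and last edges a x and y b of a geodesic: each way of swapping their
  -- ends maps a strictly shorter walk onto one from a to b.
  fixing-edge-pair-distant : ∀ {k a b} → Geodesic (suc (suc k)) a b → FixingEdgePair a b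
  fixing-edge-pair-distant {k} {a} {b} (_∷_ {w = x} e w , shortest) with unsnoc w
  ... | y , w′ , f = (_ , e) , (_ , f) , fixed
    where
    fixed : ∀ φ → FixesEdge φ (a , x) → FixesEdge φ (y , b) → Fixes φ a × Fixes φ b
    fixed φ (inj₁ (φa≡a , _)) (inj₁ (_ , φb≡b)) = φa≡a , φb≡b
    fixed φ (inj₂ (_ , φx≡a)) (inj₁ (_ , φb≡b)) =
      contradiction (transport-walk φ φx≡a φb≡b w) (shortest (n<1+n (suc k)))
    fixed φ (inj₁ (φa≡a , _)) (inj₂ (φy≡b , _)) =
      contradiction (transport-walk φ φa≡a φy≡b (e ∷ w′)) (shortest (n<1+n (suc k)))
    fixed φ (inj₂ (_ , φx≡a)) (inj₂ (φy≡b , _)) =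
      contradiction (transport-walk φ φx≡a φy≡b w′) (shortest (m<n⇒m<1+n (n<1+n k)))

  fixing-edge-pair : Connected G → ∀ {a b c k} → a ≢ b → c ≢ a → c ≢ b →
                     Geodesic k a b → FixingEdgePair a b
  fixing-edge-pair _ a≢b _ _ ([] , _) = contradiction refl a≢b
  fixing-edge-pair conn {a} {b} {c} a≢b c≢a c≢b (e ∷ [] , _)
    with crossing-step (one-of? a b) (conn a c) (inj₁ refl) [ c≢a , c≢b ]′
  ... | _ , _ , w∈ab , z∉ab , f = fixing-edge-pair-adjacent a≢b e f w∈ab z∉ab
  fixing-edge-pair _ _ _ _ g@(_ ∷ _ ∷ _ , _) = fixing-edge-pair-distant g

  edge-determining-set-of-fixing-edges :
    ∀ {a b} rest → FixingEdgePair a b → (∀ v → FixingEdge a v) →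
    IsVertexDetermining G (a ∷ b ∷ rest) →
    Σ[ T ∈ List (Edge G) ] IsEdgeDetermining G T × length T ≡ length (a ∷ b ∷ rest)
  edge-determining-set-of-fixing-edges rest (e , f , fixes-ab) fixes determining =
    e ∷ f ∷ T , edge-determining , cong (2 +_) (length-map _ rest)
    where
    T = map (proj₁ ∘ fixes) rest
    edge-determining : IsEdgeDetermining G (e ∷ f ∷ T)
    edge-determining φ (φe ∷ φf ∷ φT) =
      let φa≡a , φb≡b = fixes-ab φ φe φf
      in determining φ (φa≡a ∷ φb≡b ∷ All.map (λ {v} → proj₂ (fixes v) φ φa≡a) (map⁻ φT))

module _ {m : ℕ} (G : Graph (suc (suc (suc m)))) (conn : Connected G) where

  has-neighbour : ∀ v → ∃ (Adj G v)
  has-neighbour v = star-first-step (≢-sym (punchInᵢ≢i v zero)) (conn v (punchIn v zero))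

  ¬¬-fixing-edges : ∀ a → ¬ ¬ (∀ v → FixingEdge G a v)
  ¬¬-fixing-edges a = do
    geodesics ← ¬¬-pull-Fin λ v → ¬¬-geodesic-connected G conn v a
    pure λ v → fixing-edge G (proj₂ (geodesics v)) (has-neighbour v)

  ¬¬-edge-determining-set :
    ∀ S → IsVertexDetermining G S → (∀ S′ → IsVertexDetermining G S′ → length S ≤ length S′) →
    length S ≢ 1 → ¬ ¬ (Σ[ T ∈ List (Edge G) ] IsEdgeDetermining G T × length T ≡ length S)
  ¬¬-edge-determining-set [] determining _ _ = pure ([] , (λ φ _ → determining φ []) , refl)
  ¬¬-edge-determining-set (_ ∷ []) _ _ ∣S∣≢1 = contradiction refl ∣S∣≢1
  ¬¬-edge-determining-set (a ∷ b ∷ rest) determining minimal _ with a ≟ b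
  ... | yes refl = contradiction (minimal (a ∷ rest) without-repeat) 1+n≰n
    where
    without-repeat : IsVertexDetermining G (a ∷ rest)
    without-repeat φ (φa≡a ∷ φrest) = determining φ (φa≡a ∷ φa≡a ∷ φrest)
  ... | no a≢b = do
    let c , c≢a , c≢b = avoid-two a b
    _ , geodesic ← ¬¬-geodesic-connected G conn a b
    fixes ← ¬¬-fixing-edges a
    pure (edge-determining-set-of-fixing-edges G rest
            (fixing-edge-pair G conn a≢b c≢a c≢b geodesic) fixes determining)

theorem4 : ∀ {n} (G : Graph n) → Connected G → 3 ≤ n →
    ∀ d d' → IsDet G d → IsEdgeDet G d' → d ≢ 1 → d' ≤ d
theorem4 G conn (s≤s (s≤s (s≤s _))) _ d' ((S , S-determining , refl) , S-minimal) (_ , T-minimal) d≢1 =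
  decidable-stable (d' ≤? length S)
    (¬¬-map (λ (T , T-determining , ∣T∣≡∣S∣) → subst (d' ≤_) ∣T∣≡∣S∣ (T-minimal T T-determining))
            (¬¬-edge-determining-set G conn S S-determining S-minimal d≢1))
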